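{- Let $B$ be an $(m+1)\times(m+1)$ alternating sign matrix. Let $A^{\max}$ be the $m\times m$ alternating sign matrix whose left corner sum matrix is $\bar A^{\max}_{i,j}=\min(\bar B_{i,j+1},\bar B_{i+1,j})$, and let $A_{\min}$ be the $m\times m$ alternating sign matrix whose right corner sum matrix is $\underline A_{\min,i,j}=\max(\underline B_{i,j+1},\underline B_{i+1,j}-1)$ ($1\le i,j\le m$). Then $A_{\min}=A^{\max}$.
   Context: An alternating sign matrix (ASM) is a square matrix with entries in $\{0,1,-1\}$ whose row and column sums are all $1$ and whose nonzero entries alternate in sign along every row and column. For an $r\times r$ ASM $X$, the left corner sum matrix is $\bar X_{i,j}=\sum_{i'\le i,j'\le j}X_{i',j'}$ and the right corner sum matrix is $\underline X_{i,j}=\sum_{i'\le i,j'\ge j}X_{i',j'}$; an ASM is determined by either. $A^{\max}$ is the entrywise-largest among ASMs $A$ left interlacing with $B$ (i.e. $\max(\bar B_{i,j},\bar B_{i+1,j+1}-1)\le\bar A_{i,j}\le\min(\bar B_{i,j+1},\bar B_{i+1,j})$), and $A_{\min}$ is the entrywise-smallest among ASMs $A$ right interlacing with $B$ (i.e. $\max(\underline B_{i,j+1},\underline B_{i+1,j}-1)\le\underline A_{i,j}\le\min(\underline B_{i,j},\underline B_{i+1,j+1})$). -}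

module Defs where

open import Data.Nat using (ℕ; zero; suc)
open import Data.Fin using (Fin; zero; suc; inject₁; _≤_; _<_; _≤?_)
open import Data.Integer using (ℤ; 0ℤ; 1ℤ; -1ℤ; _+_; _-_; -_) renaming (_⊓_ to minℤ; _⊔_ to maxℤ)
open import Data.Product using (_×_)
open import Data.Sum using (_⊎_)
open import Relation.Binary.PropositionalEquality using (_≡_; _≢_)
open import Relation.Nullary.Decidable using (does)
open import Data.Bool using (if_then_else_; _∧_)

-- r × r integer matrices, indices 0-based (Fin r); index k corresponds to the paper's k+1.
Matrix : ℕ → Set
Matrix r = Fin r → Fin r → ℤ

sumFin : (n : ℕ) → (Fin n → ℤ) → ℤ
sumFin zero    f = 0ℤ
sumFin (suc n) f = f zero + sumFin n (λ k → f (suc k))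

rowSum : ∀ {r} → Matrix r → Fin r → ℤ
rowSum {r} X i = sumFin r (λ j → X i j)

colSum : ∀ {r} → Matrix r → Fin r → ℤ
colSum {r} X j = sumFin r (λ i → X i j)

Alternating : ∀ {r} → (Fin r → ℤ) → Set
Alternating {r} v =
  ∀ (a b : Fin r) → a < b → v a ≢ 0ℤ → v b ≢ 0ℤ →
  (∀ (c : Fin r) → a < c → c < b → v c ≡ 0ℤ) →
  v b ≡ - v a

record IsASM {r : ℕ} (X : Matrix r) : Set where
  field
    entries  : ∀ i j → (X i j ≡ 0ℤ) ⊎ ((X i j ≡ 1ℤ) ⊎ (X i j ≡ -1ℤ))
    rowSums  : ∀ i → rowSum X i ≡ 1ℤ
    colSums  : ∀ j → colSum X j ≡ 1ℤ
    rowsAlt  : ∀ i → Alternating (λ j → X i j)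
    colsAlt  : ∀ j → Alternating (λ i → X i j)

leftCS : ∀ {r} → Matrix r → Fin r → Fin r → ℤ
leftCS {r} X i j =
  sumFin r (λ i' → sumFin r (λ j' →
    if does (i' ≤? i) ∧ does (j' ≤? j) then X i' j' else 0ℤ))

rightCS : ∀ {r} → Matrix r → Fin r → Fin r → ℤ
rightCS {r} X i j =
  sumFin r (λ i' → sumFin r (λ j' →
    if does (i' ≤? i) ∧ does (j ≤? j') then X i' j' else 0ℤ))

-- the defining formula for A^max (paper indices 1 ≤ i,j ≤ m; here i,j : Fin m,
-- paper i ↦ inject₁ i, paper i+1 ↦ suc i in Fin (m+1)):
--   \bar A^max_{i,j} = min(\bar B_{i,j+1}, \bar B_{i+1,j})
AmaxCS : ∀ {m} → Matrix (suc m) → Fin m → Fin m → ℤ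
AmaxCS B i j = minℤ (leftCS B (inject₁ i) (suc j)) (leftCS B (suc i) (inject₁ j))

AminCS : ∀ {m} → Matrix (suc m) → Fin m → Fin m → ℤ
AminCS B i j = maxℤ (rightCS B (inject₁ i) (suc j)) (rightCS B (suc i) (inject₁ j) - 1ℤ)

-- Summing the row sums of a matrix whose rows all sum to 1 over its first i rows gives the
-- complement relation  \underline X_{i,j+1} = i - \bar X_{i,j}  and  \underline X_{i,1} = i.
-- Applied to B, it turns the maximum defining \underline A_min_{i,j+1} into i minus the minimum
-- defining \bar A^max_{i,j}; applied to A^max, that is \underline A^max_{i,j+1}.  So A_min and
-- A^max have the same right corner sums, and right corner sums determine a matrix.

module Submission where

open import Defs
open import Data.Nat using (ℕ; zero; suc)
open import Data.Fin using (Fin; zero; suc; inject₁; toℕ; _≤?_)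
open import Data.Fin.Properties using (toℕ-inject₁)
open import Data.Integer using (ℤ; +_; 0ℤ; 1ℤ; _+_; _-_) renaming (_⊓_ to minℤ; _⊔_ to maxℤ)
open import Data.Integer.Properties
  using (+-identityˡ; +-identityʳ; +-comm; +-0-abelianGroup; +-commutativeSemigroup; +-monoʳ-≤; neg-mono-≤; antimono-≤-distrib-⊓)
open import Algebra.Properties.AbelianGroup +-0-abelianGroup using (∙-cancelˡ; ∙-cancelʳ; x≈z//y)
open import Data.Integer.Tactic.RingSolver using (solve-∀)
open import Algebra.Properties.CommutativeSemigroup +-commutativeSemigroup using (interchange; x∙yz≈y∙xz)
open import Relation.Binary.PropositionalEquality using (_≡_; refl; sym; trans; cong; cong₂; module ≡-Reasoning)
open import Relation.Nullary.Decidable using (does)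
open import Data.Bool using (Bool; true; false; if_then_else_; _∧_)
open import Function using (_∘_)

sumFin-cong : ∀ {n} {f g : Fin n → ℤ} → (∀ k → f k ≡ g k) → sumFin n f ≡ sumFin n g
sumFin-cong {zero}  eq = refl
sumFin-cong {suc n} eq = cong₂ _+_ (eq zero) (sumFin-cong (eq ∘ suc))

sumFin-zero : ∀ n → sumFin n (λ _ → 0ℤ) ≡ 0ℤ
sumFin-zero zero    = refl
sumFin-zero (suc n) = trans (+-identityˡ _) (sumFin-zero n)

sumFin-+ : ∀ {n} (f g : Fin n → ℤ) → sumFin n (λ k → f k + g k) ≡ sumFin n f + sumFin n g
sumFin-+ {zero}  f g = refl
sumFin-+ {suc n} f g = begin
  (f zero + g zero) + sumFin n (λ k → f (suc k) + g (suc k))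
    ≡⟨ cong (_+_ (f zero + g zero)) (sumFin-+ (f ∘ suc) (g ∘ suc)) ⟩
  (f zero + g zero) + (sumFin n (f ∘ suc) + sumFin n (g ∘ suc))
    ≡⟨ interchange (f zero) (g zero) (sumFin n (f ∘ suc)) (sumFin n (g ∘ suc)) ⟩
  (f zero + sumFin n (f ∘ suc)) + (g zero + sumFin n (g ∘ suc)) ∎
  where open ≡-Reasoning

mask : Bool → ℤ → ℤ
mask b x = if b then x else 0ℤ

mask-+ : ∀ b x y → mask b (x + y) ≡ mask b x + mask b y
mask-+ true  x y = refl
mask-+ false x y = refl

prefixSum : ∀ {n} → (Fin n → ℤ) → Fin n → ℤ
prefixSum {n} f a = sumFin n (λ k → mask (does (k ≤? a)) (f k))

suffixSum : ∀ {n} → (Fin n → ℤ) → Fin n → ℤ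
suffixSum {n} f a = sumFin n (λ k → mask (does (a ≤? k)) (f k))

does-suc≤?suc : ∀ {n} (i j : Fin n) → does (suc i ≤? suc j) ≡ does (i ≤? j)
-- suc m ≤ᵇ suc n only reduces to m ≤ᵇ n once m is split into zero or suc.
does-suc≤?suc i j with toℕ i
... | zero  = refl
... | suc _ = refl

prefixSum-cong : ∀ {n} {f g : Fin n → ℤ} → (∀ k → f k ≡ g k) → ∀ a → prefixSum f a ≡ prefixSum g a
prefixSum-cong eq a = sumFin-cong (λ k → cong (mask (does (k ≤? a))) (eq k))

prefixSum-+ : ∀ {n} (f g : Fin n → ℤ) a →
  prefixSum (λ k → f k + g k) a ≡ prefixSum f a + prefixSum g a
prefixSum-+ f g a =
  trans (sumFin-cong (λ k → mask-+ (does (k ≤? a)) (f k) (g k)))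
        (sumFin-+ (λ k → mask (does (k ≤? a)) (f k)) (λ k → mask (does (k ≤? a)) (g k)))

prefixSum-zero : ∀ {n} (f : Fin (suc n) → ℤ) → prefixSum f zero ≡ f zero
prefixSum-zero {n} f = trans (cong (_+_ (f zero)) (sumFin-zero n)) (+-identityʳ (f zero))

prefixSum-suc : ∀ {n} (f : Fin (suc n) → ℤ) a → prefixSum f (suc a) ≡ f zero + prefixSum (f ∘ suc) a
prefixSum-suc f a = cong (_+_ (f zero)) (sumFin-cong (λ k → cong (λ b → mask b (f (suc k))) (does-suc≤?suc k a)))

suffixSum-suc : ∀ {n} (f : Fin (suc n) → ℤ) a → suffixSum f (suc a) ≡ suffixSum (f ∘ suc) a
suffixSum-suc f a = trans (+-identityˡ _) (sumFin-cong (λ k → cong (λ b → mask b (f (suc k))) (does-suc≤?suc a k)))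

prefixSum-one : ∀ {n} (a : Fin n) → prefixSum (λ _ → 1ℤ) a ≡ + suc (toℕ a)
prefixSum-one {suc n} zero = prefixSum-zero {n} (λ _ → 1ℤ)
prefixSum-one (suc a)      = trans (prefixSum-suc (λ _ → 1ℤ) a) (cong (_+_ 1ℤ) (prefixSum-one a))

suffixSum-suc-+-prefixSum-inject₁ : ∀ {n} (f : Fin (suc n) → ℤ) (b : Fin n) →
  suffixSum f (suc b) + prefixSum f (inject₁ b) ≡ sumFin (suc n) f
suffixSum-suc-+-prefixSum-inject₁ {suc n} f zero =
  trans (cong₂ _+_ (suffixSum-suc f zero) (prefixSum-zero f)) (+-comm _ (f zero))
suffixSum-suc-+-prefixSum-inject₁ {suc n} f (suc b) = begin
  suffixSum f (suc (suc b)) + prefixSum f (suc (inject₁ b))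
    ≡⟨ cong₂ _+_ (suffixSum-suc f (suc b)) (prefixSum-suc f (inject₁ b)) ⟩
  suffixSum (f ∘ suc) (suc b) + (f zero + prefixSum (f ∘ suc) (inject₁ b))
    ≡⟨ x∙yz≈y∙xz (suffixSum (f ∘ suc) (suc b)) (f zero) (prefixSum (f ∘ suc) (inject₁ b)) ⟩
  f zero + (suffixSum (f ∘ suc) (suc b) + prefixSum (f ∘ suc) (inject₁ b))
    ≡⟨ cong (_+_ (f zero)) (suffixSum-suc-+-prefixSum-inject₁ (f ∘ suc) b) ⟩
  f zero + sumFin (suc n) (f ∘ suc) ∎
  where open ≡-Reasoning

prefixSum-injective : ∀ {n} (f g : Fin n → ℤ) → (∀ a → prefixSum f a ≡ prefixSum g a) → ∀ k → f k ≡ g k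
prefixSum-injective f g eq zero = trans (sym (prefixSum-zero f)) (trans (eq zero) (prefixSum-zero g))
prefixSum-injective f g eq (suc k) = prefixSum-injective (f ∘ suc) (g ∘ suc) tails-eq k
  where
  tails-eq : ∀ a → prefixSum (f ∘ suc) a ≡ prefixSum (g ∘ suc) a
  tails-eq a = ∙-cancelˡ (f zero) _ _ (begin
    f zero + prefixSum (f ∘ suc) a ≡⟨ prefixSum-suc f a ⟨
    prefixSum f (suc a)            ≡⟨ eq (suc a) ⟩
    prefixSum g (suc a)            ≡⟨ prefixSum-suc g a ⟩
    g zero + prefixSum (g ∘ suc) a ≡⟨ cong (_+ prefixSum (g ∘ suc) a) (prefixSum-injective f g eq zero) ⟨
    f zero + prefixSum (g ∘ suc) a ∎)
    where open ≡-Reasoning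

suffixSum-∘suc-≡ : ∀ {n} (f g : Fin (suc n) → ℤ) → (∀ a → suffixSum f a ≡ suffixSum g a) →
  ∀ a → suffixSum (f ∘ suc) a ≡ suffixSum (g ∘ suc) a
suffixSum-∘suc-≡ f g eq a = trans (sym (suffixSum-suc f a)) (trans (eq (suc a)) (suffixSum-suc g a))

suffixSum-injective : ∀ {n} (f g : Fin n → ℤ) → (∀ a → suffixSum f a ≡ suffixSum g a) → ∀ k → f k ≡ g k
suffixSum-injective {suc n} f g eq zero = ∙-cancelʳ (sumFin n (f ∘ suc)) (f zero) (g zero) (begin
  f zero + sumFin n (f ∘ suc) ≡⟨ eq zero ⟩
  g zero + sumFin n (g ∘ suc) ≡⟨ cong (_+_ (g zero)) (sumFin-cong tails-equal) ⟨
  g zero + sumFin n (f ∘ suc) ∎)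
  where
  open ≡-Reasoning
  tails-equal : ∀ k → f (suc k) ≡ g (suc k)
  tails-equal = suffixSum-injective (f ∘ suc) (g ∘ suc) (suffixSum-∘suc-≡ f g eq)
suffixSum-injective f g eq (suc k) = suffixSum-injective (f ∘ suc) (g ∘ suc) (suffixSum-∘suc-≡ f g eq) k

sumFin-mask-∧ : ∀ {n} (b : Bool) (c : Fin n → Bool) (x : Fin n → ℤ) →
  sumFin n (λ k → mask (b ∧ c k) (x k)) ≡ mask b (sumFin n (λ k → mask (c k) (x k)))
sumFin-mask-∧ true  c x = refl
sumFin-mask-∧ {n} false c x = sumFin-zero n

leftCS≡prefixSum-prefixSum : ∀ {r} (X : Matrix r) i j → leftCS X i j ≡ prefixSum (λ i' → prefixSum (X i') j) i
leftCS≡prefixSum-prefixSum X i j = sumFin-cong (λ i' → sumFin-mask-∧ (does (i' ≤? i)) (λ j' → does (j' ≤? j)) (X i'))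

rightCS≡prefixSum-suffixSum : ∀ {r} (X : Matrix r) i j → rightCS X i j ≡ prefixSum (λ i' → suffixSum (X i') j) i
rightCS≡prefixSum-suffixSum X i j = sumFin-cong (λ i' → sumFin-mask-∧ (does (i' ≤? i)) (λ j' → does (j ≤? j')) (X i'))

rightCS-injective : ∀ {r} (X Y : Matrix r) → (∀ i j → rightCS X i j ≡ rightCS Y i j) → ∀ i j → X i j ≡ Y i j
rightCS-injective X Y eq i = suffixSum-injective (X i) (Y i) (λ j →
  prefixSum-injective (λ i' → suffixSum (X i') j) (λ i' → suffixSum (Y i') j) (λ i' → begin
    prefixSum (λ i' → suffixSum (X i') j) i' ≡⟨ rightCS≡prefixSum-suffixSum X i' j ⟨
    rightCS X i' j                          ≡⟨ eq i' j ⟩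
    rightCS Y i' j                          ≡⟨ rightCS≡prefixSum-suffixSum Y i' j ⟩
    prefixSum (λ i' → suffixSum (Y i') j) i' ∎) i)
  where open ≡-Reasoning

rightCS-zero : ∀ {r} (X : Matrix (suc r)) i → rightCS X i zero ≡ prefixSum (rowSum X) i
rightCS-zero X i = rightCS≡prefixSum-suffixSum X i zero

rightCS-suc-+-leftCS-inject₁ : ∀ {r} (X : Matrix (suc r)) i (j : Fin r) →
  rightCS X i (suc j) + leftCS X i (inject₁ j) ≡ prefixSum (rowSum X) i
rightCS-suc-+-leftCS-inject₁ X i j = begin
  rightCS X i (suc j) + leftCS X i (inject₁ j)
    ≡⟨ cong₂ _+_ (rightCS≡prefixSum-suffixSum X i (suc j)) (leftCS≡prefixSum-prefixSum X i (inject₁ j)) ⟩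
  prefixSum (λ i' → suffixSum (X i') (suc j)) i + prefixSum (λ i' → prefixSum (X i') (inject₁ j)) i
    ≡⟨ prefixSum-+ (λ i' → suffixSum (X i') (suc j)) (λ i' → prefixSum (X i') (inject₁ j)) i ⟨
  prefixSum (λ i' → suffixSum (X i') (suc j) + prefixSum (X i') (inject₁ j)) i
    ≡⟨ prefixSum-cong (λ i' → suffixSum-suc-+-prefixSum-inject₁ (X i') j) i ⟩
  prefixSum (rowSum X) i ∎
  where open ≡-Reasoning

prefixSum-rowSum : ∀ {r} (X : Matrix r) → (∀ i → rowSum X i ≡ 1ℤ) → ∀ i → prefixSum (rowSum X) i ≡ + suc (toℕ i)
prefixSum-rowSum X rowSums-one i = trans (prefixSum-cong rowSums-one i) (prefixSum-one i)

rightCS-suc≡sub-leftCS : ∀ {r} (X : Matrix (suc r)) → (∀ i → rowSum X i ≡ 1ℤ) → ∀ i (j : Fin r) →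
  rightCS X i (suc j) ≡ + suc (toℕ i) - leftCS X i (inject₁ j)
rightCS-suc≡sub-leftCS X rowSums-one i j =
  x≈z//y _ _ _ (trans (rightCS-suc-+-leftCS-inject₁ X i j) (prefixSum-rowSum X rowSums-one i))

sub-⊓≡sub-⊔-sub : ∀ c p q → c - minℤ p q ≡ maxℤ (c - p) (c - q)
sub-⊓≡sub-⊔-sub c = antimono-≤-distrib-⊓ (λ p≤q → +-monoʳ-≤ c (neg-mono-≤ p≤q))

[1+c-q]-1≡c-q : ∀ c q → ((1ℤ + c) - q) - 1ℤ ≡ c - q
[1+c-q]-1≡c-q = solve-∀

AminCS-suc≡sub-AmaxCS : ∀ {m} (B : Matrix (suc (suc m))) → (∀ i → rowSum B i ≡ 1ℤ) → ∀ i (j : Fin m) →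
  AminCS B i (suc j) ≡ + suc (toℕ i) - AmaxCS B i (inject₁ j)
AminCS-suc≡sub-AmaxCS B rowSums-one i j = begin
  maxℤ (rightCS B (inject₁ i) (suc (suc j))) (rightCS B (suc i) (suc (inject₁ j)) - 1ℤ)
    ≡⟨ cong₂ maxℤ upper-row lower-row ⟩
  maxℤ (c - leftCS B (inject₁ i) (suc (inject₁ j))) (c - leftCS B (suc i) (inject₁ (inject₁ j)))
    ≡⟨ sub-⊓≡sub-⊔-sub c (leftCS B (inject₁ i) (suc (inject₁ j))) (leftCS B (suc i) (inject₁ (inject₁ j))) ⟨
  c - AmaxCS B i (inject₁ j) ∎
  where
  open ≡-Reasoning
  c : ℤ
  c = + suc (toℕ i)
  upper-row : rightCS B (inject₁ i) (suc (suc j)) ≡ c - leftCS B (inject₁ i) (suc (inject₁ j))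
  upper-row = trans (rightCS-suc≡sub-leftCS B rowSums-one (inject₁ i) (suc j))
                    (cong (λ k → + suc k - leftCS B (inject₁ i) (suc (inject₁ j))) (toℕ-inject₁ i))
  lower-row : rightCS B (suc i) (suc (inject₁ j)) - 1ℤ ≡ c - leftCS B (suc i) (inject₁ (inject₁ j))
  lower-row = trans (cong (_- 1ℤ) (rightCS-suc≡sub-leftCS B rowSums-one (suc i) (inject₁ j)))
                    ([1+c-q]-1≡c-q c (leftCS B (suc i) (inject₁ (inject₁ j))))

proposition6p4p1 : (m : ℕ) (B : Matrix (suc m)) → IsASM B →
    (Amax Amin : Matrix m) → IsASM Amax → IsASM Amin →
    (∀ i j → leftCS Amax i j ≡ AmaxCS B i j) →
    (∀ i j → rightCS Amin i j ≡ AminCS B i j) →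
    ∀ i j → Amin i j ≡ Amax i j
proposition6p4p1 zero    _ _ _ _ _ _ _ _ ()
proposition6p4p1 (suc m) B asmB Amax Amin asmAmax asmAmin Amax-leftCS Amin-rightCS =
  rightCS-injective Amin Amax rightCS-agree
  where
  open IsASM using (rowSums)
  open ≡-Reasoning
  rightCS-agree : ∀ i j → rightCS Amin i j ≡ rightCS Amax i j
  rightCS-agree i zero = begin
    rightCS Amin i zero          ≡⟨ rightCS-zero Amin i ⟩
    prefixSum (rowSum Amin) i    ≡⟨ prefixSum-rowSum Amin (rowSums asmAmin) i ⟩
    + suc (toℕ i)                ≡⟨ prefixSum-rowSum Amax (rowSums asmAmax) i ⟨
    prefixSum (rowSum Amax) i    ≡⟨ rightCS-zero Amax i ⟨
    rightCS Amax i zero          ∎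
  rightCS-agree i (suc j) = begin
    rightCS Amin i (suc j)                     ≡⟨ Amin-rightCS i (suc j) ⟩
    AminCS B i (suc j)                         ≡⟨ AminCS-suc≡sub-AmaxCS B (rowSums asmB) i j ⟩
    + suc (toℕ i) - AmaxCS B i (inject₁ j)     ≡⟨ cong (_-_ (+ suc (toℕ i))) (Amax-leftCS i (inject₁ j)) ⟨
    + suc (toℕ i) - leftCS Amax i (inject₁ j)  ≡⟨ rightCS-suc≡sub-leftCS Amax (rowSums asmAmax) i j ⟨
    rightCS Amax i (suc j)                     ∎
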